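{- Let $n$ be an integer with $n\ge 4$ and let $k\in\{2,3,\ldots,\lfloor n/2\rfloor\}$. Then $$\binom nk<e^{ -\frac {11(k-1)}{12n^2}}\frac{n(n-1)^{n-1}}{k^k(n-k)^{n-k}} <\Big(1-\frac{5(k-1)}{6n^2}\Big) \frac{n(n-1)^{n-1}}{k^k(n-k)^{n-k}}.$$
   Context: $\lfloor x\rfloor$ denotes the greatest integer not exceeding $x$. -}

module Defs where

open import Data.Nat as ℕ using (ℕ; zero; suc; _!)
open import Data.Integer using (+_)
open import Data.Rational using (ℚ; 0ℚ; 1ℚ; _+_; _*_; _/_; _<_; _≤_)
open import Data.Product using (Σ; _×_)

-- ratio a b = a / b as a rational, for b ≥ 1 (only used with b ≥ 1;
-- the value for b = 0 is an irrelevant junk value 0).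
ratio : ℕ → ℕ → ℚ
ratio a zero    = 0ℚ
ratio a (suc b) = (+ a) / suc b

infixr 8 _^ℚ_
_^ℚ_ : ℚ → ℕ → ℚ
x ^ℚ zero  = 1ℚ
x ^ℚ suc m = x * (x ^ℚ m)

expPartial : ℚ → ℕ → ℚ
expPartial x zero    = 0ℚ
expPartial x (suc N) = expPartial x N + (x ^ℚ N) * ratio 1 (N !)

-- For a ≥ 0, exp a = sup_N expPartial a N (increasing partial sums).
-- Hence, for c ≥ 0 and rationals r:
--   c * exp a < r   iff  ∃ δ > 0, ∀ N, c * expPartial a N + δ ≤ r
--   r < c * exp a   iff  ∃ N, r < c * expPartial a N
MulExpLt : ℚ → ℚ → ℚ → Set
MulExpLt c a r = Σ ℚ λ δ → (0ℚ < δ) × ((N : ℕ) → c * expPartial a N + δ ≤ r)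

LtMulExp : ℚ → ℚ → ℚ → Set
LtMulExp r c a = Σ ℕ λ N → r < c * expPartial a N

-- c < e^{-a} · r   (a ≥ 0, r real positive)  ⇔  c · e^{a} < r
_<e^-_·_ : ℚ → ℚ → ℚ → Set
c <e^- a · r = MulExpLt c a r

-- e^{-a} · r < s   (a ≥ 0)  ⇔  r < s · e^{a}
e^-_·_<_ : ℚ → ℚ → ℚ → Set
e^- a · r < s = LtMulExp r s a

module Submission where

-- Let D(n,k) = C(n,k) k^k (n−k)^(n−k). Since (k+1) C(n,k+1) = (n−k) C(n,k), the quotient
-- D(n,k+1)/D(n,k) is (1+1/k)^k / (1+1/m)^m with m = n−k−1 ≥ k, hence at most 1 because
-- (1+1/m)^m increases. So D(n,k) ≤ D(n,2) = 2n(n−1)(n−2)^(n−2) ≤ (8/9) n(n−1)^(n−1) for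
-- 2 ≤ k ≤ n/2, the last step by (1+1/(n−2))^(n−2) ≥ 9/4. As a = 11(k−1)/(12n²) ≤ 1/10, the
-- partial sums of e^a stay below the geometric bound 10/9 < 9/8: the first inequality.
-- The second asks for (1−b) e^a > 1 with b = 5(k−1)/(6n²); already (1−b)(1+a) > 1, which
-- amounts to 110(k−1) < 12n².

open import Defs

module Binomial where
  open import Data.Nat
  open import Data.Nat.Properties
  open import Data.Nat.Combinatorics using (_C_; nCk≡n!/k![n-k]!; k![n∸k]!∣n!; [n-k]*d[k+1]≡[k+1]*d[k]; nC1≡n)
  open import Data.Nat.DivMod using (m/n*n≡m)
  open import Data.Nat.Tactic.RingSolver using (solve-∀)
  open import Relation.Binary.PropositionalEquality

  ^-distribʳ-* : ∀ m n o → (m * n) ^ o ≡ m ^ o * n ^ o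
  ^-distribʳ-* m n zero    = refl
  ^-distribʳ-* m n (suc o) = trans (cong (m * n *_) (^-distribʳ-* m n o)) (interchange m n (m ^ o) (n ^ o))
    where
    interchange : ∀ a b c d → a * b * (c * d) ≡ a * c * (b * d)
    interchange = solve-∀

  [1+x]^[1+i]≤x^[1+i]+[1+i]*[1+x]^i : ∀ x i → suc x ^ suc i ≤ x ^ suc i + suc i * suc x ^ i
  [1+x]^[1+i]≤x^[1+i]+[1+i]*[1+x]^i x zero = ≤-reflexive (+-comm 1 (x * 1))
  [1+x]^[1+i]≤x^[1+i]+[1+i]*[1+x]^i x (suc i) = begin
      suc x * suc x ^ suc i                     ≤⟨ *-monoʳ-≤ (suc x) ([1+x]^[1+i]≤x^[1+i]+[1+i]*[1+x]^i x i) ⟩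
      suc x * (X + suc i * Y)                   ≡⟨ expand x X Y i ⟩
      x * X + X + suc i * (suc x * Y)           ≤⟨ +-monoˡ-≤ _ (+-monoʳ-≤ (x * X) (^-monoˡ-≤ (suc i) (n≤1+n x))) ⟩
      x * X + suc x * Y + suc i * (suc x * Y)   ≡⟨ collect x X Y i ⟩
      x * X + suc (suc i) * (suc x * Y)         ∎
    where
    open ≤-Reasoning
    X Y : ℕ
    X = x ^ suc i
    Y = suc x ^ i
    expand : ∀ x X Y i → suc x * (X + suc i * Y) ≡ x * X + X + suc i * (suc x * Y)
    expand = solve-∀
    collect : ∀ x X Y i → x * X + suc x * Y + suc i * (suc x * Y) ≡ x * X + suc (suc i) * (suc x * Y)
    collect = solve-∀

  -- (1 + 1/m)^m ≤ (1 + 1/(m+1))^(m+1), cross-multiplied; the bound above at x = m(m+2),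
  -- for which x + 1 = (m+1)².
  [1+1/n]^n-step : ∀ m .{{_ : NonZero m}} → suc m ^ m * suc m ^ suc m ≤ m ^ m * (2 + m) ^ suc m
  [1+1/n]^n-step m = *-cancelˡ-≤ m (+-cancelʳ-≤ (suc m * (S * S)) _ _ (begin
      m * (S * suc m ^ suc m) + suc m * (S * S) ≡⟨ split m S ⟩
      suc m ^ suc m * suc m ^ suc m             ≡⟨ ^-distribʳ-* (suc m) (suc m) (suc m) ⟨
      (suc m * suc m) ^ suc m                   ≡⟨ cong (_^ suc m) square ⟩
      suc x ^ suc m                             ≤⟨ [1+x]^[1+i]≤x^[1+i]+[1+i]*[1+x]^i x m ⟩
      x ^ suc m + suc m * suc x ^ m             ≡⟨ cong₂ (λ u v → u + suc m * v) (^-distribʳ-* m (2 + m) (suc m))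
                                                     (trans (cong (_^ m) (sym square)) (^-distribʳ-* (suc m) (suc m) m)) ⟩
      m ^ suc m * T + suc m * (S * S)           ≡⟨ cong (_+ suc m * (S * S)) (*-assoc m (m ^ m) T) ⟩
      m * (m ^ m * T) + suc m * (S * S)         ∎))
    where
    open ≤-Reasoning
    S T x : ℕ
    S = suc m ^ m
    T = (2 + m) ^ suc m
    x = m * (2 + m)
    square : suc m * suc m ≡ suc x
    square = square-as-product m
      where
      square-as-product : ∀ m → suc m * suc m ≡ suc (m * (2 + m))
      square-as-product = solve-∀
    split : ∀ m S → m * (S * (suc m * S)) + suc m * (S * S) ≡ (suc m * S) * (suc m * S)
    split = solve-∀

  [1+1/n]^n-mono : ∀ {k m} .{{_ : NonZero k}} → k ≤ m → suc k ^ k * m ^ m ≤ k ^ k * suc m ^ m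
  [1+1/n]^n-mono {k} k≤m = go (≤⇒≤′ k≤m)
    where
    go : ∀ {m} → k ≤′ m → suc k ^ k * m ^ m ≤ k ^ k * suc m ^ m
    go ≤′-refl = ≤-reflexive (*-comm (suc k ^ k) (k ^ k))
    go (≤′-step {m} k≤′m) = *-cancelʳ-≤ _ _ (M * S) (begin
        suc k ^ k * suc m ^ suc m * (M * S)   ≡⟨ regroup (suc k ^ k) m M S ⟩
        suc k ^ k * M * (S * suc m ^ suc m)   ≤⟨ *-mono-≤ (go k≤′m) ([1+1/n]^n-step m) ⟩
        k ^ k * S * (M * T)                   ≡⟨ swap (k ^ k) S M T ⟩
        k ^ k * T * (M * S)                   ∎)
      where
      open ≤-Reasoning
      instance
        _ : NonZero m
        _ = >-nonZero (≤-trans (>-nonZero⁻¹ k) (≤′⇒≤ k≤′m))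
        _ : NonZero (m ^ m * suc m ^ m)
        _ = m*n≢0 _ _ {{m^n≢0 m m}} {{m^n≢0 (suc m) m}}
      M S T : ℕ
      M = m ^ m
      S = suc m ^ m
      T = (2 + m) ^ suc m
      regroup : ∀ A m M S → A * (suc m * S) * (M * S) ≡ A * M * (S * (suc m * S))
      regroup = solve-∀
      swap : ∀ K S M T → K * S * (M * T) ≡ K * T * (M * S)
      swap = solve-∀

  nCk*k![n∸k]!≡n! : ∀ {n k} → k ≤ n → (n C k) * (k ! * (n ∸ k) !) ≡ n !
  nCk*k![n∸k]!≡n! {n} {k} k≤n = trans (cong (_* (k ! * (n ∸ k) !)) (nCk≡n!/k![n-k]! k≤n))
                                      (m/n*n≡m {{k !* (n ∸ k) !≢0}} (k![n∸k]!∣n! k≤n))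

  nCk≢0 : ∀ {n k} → k ≤ n → NonZero (n C k)
  nCk≢0 {n} {k} k≤n = m*n≢0⇒m≢0 (n C k) {{subst NonZero (sym (nCk*k![n∸k]!≡n! k≤n)) (n !≢0)}}

  [k+1]*nC[k+1]≡[n∸k]*nCk : ∀ {n k} → k < n → suc k * (n C suc k) ≡ (n ∸ k) * (n C k)
  [k+1]*nC[k+1]≡[n∸k]*nCk {n} {k} k<n = *-cancelʳ-≡ _ _ (k ! * (n ∸ k) !) {{k !* (n ∸ k) !≢0}} (begin
      suc k * C₁ * (k ! * (n ∸ k) !)                ≡⟨ *-assoc (suc k) C₁ _ ⟩
      suc k * (C₁ * (k ! * (n ∸ k) !))              ≡⟨ x∙yz≈y∙xz (suc k) C₁ _ ⟩
      C₁ * (suc k * (k ! * (n ∸ k) !))              ≡⟨ cong (C₁ *_) ([n-k]*d[k+1]≡[k+1]*d[k] k<n) ⟨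
      C₁ * ((n ∸ k) * (suc k ! * (n ∸ suc k) !))    ≡⟨ x∙yz≈y∙xz C₁ (n ∸ k) _ ⟩
      (n ∸ k) * (C₁ * (suc k ! * (n ∸ suc k) !))    ≡⟨ cong ((n ∸ k) *_) (nCk*k![n∸k]!≡n! k<n) ⟩
      (n ∸ k) * n !                                 ≡⟨ cong ((n ∸ k) *_) (nCk*k![n∸k]!≡n! (<⇒≤ k<n)) ⟨
      (n ∸ k) * (C₀ * (k ! * (n ∸ k) !))            ≡⟨ *-assoc (n ∸ k) C₀ _ ⟨
      (n ∸ k) * C₀ * (k ! * (n ∸ k) !)              ∎)
    where
    open ≡-Reasoning
    open import Algebra.Properties.CommutativeSemigroup *-commutativeSemigroup using (x∙yz≈y∙xz)
    C₀ C₁ : ℕ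
    C₀ = n C k
    C₁ = n C suc k

  scaledBinomial : ℕ → ℕ → ℕ
  scaledBinomial n k = (n C k) * (k ^ k * (n ∸ k) ^ (n ∸ k))

  scaledBinomial-step : ∀ {n k} .{{_ : NonZero k}} → k < n ∸ k → scaledBinomial n (suc k) ≤ scaledBinomial n k
  scaledBinomial-step {n} {k} k<n∸k = begin
      C₁ * (suc k ^ suc k * M)           ≡⟨ regroup C₁ k (suc k ^ k) M ⟩
      suc k * C₁ * (suc k ^ k * M)       ≡⟨ cong (_* (suc k ^ k * M)) ([k+1]*nC[k+1]≡[n∸k]*nCk k<n) ⟩
      (n ∸ k) * C₀ * (suc k ^ k * M)     ≡⟨ cong (λ z → z * C₀ * (suc k ^ k * M)) n∸k≡1+m ⟩
      suc m * C₀ * (suc k ^ k * M)       ≤⟨ *-monoʳ-≤ (suc m * C₀) ([1+1/n]^n-mono k≤m) ⟩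
      suc m * C₀ * (k ^ k * suc m ^ m)   ≡⟨ regroup′ m C₀ (k ^ k) (suc m ^ m) ⟩
      C₀ * (k ^ k * suc m ^ suc m)       ≡⟨ cong (λ z → C₀ * (k ^ k * z ^ z)) n∸k≡1+m ⟨
      C₀ * (k ^ k * (n ∸ k) ^ (n ∸ k))   ∎
    where
    open ≤-Reasoning
    C₀ C₁ m M : ℕ
    C₀ = n C k
    C₁ = n C suc k
    m = n ∸ suc k
    M = m ^ m
    k<n : k < n
    k<n = <-≤-trans k<n∸k (m∸n≤m n k)
    n∸k≡1+m : n ∸ k ≡ suc m
    n∸k≡1+m = +-∸-assoc 1 k<n
    k≤m : k ≤ m
    k≤m = ≤-pred (subst (k <_) n∸k≡1+m k<n∸k)
    regroup : ∀ C k K M → C * (suc k * K * M) ≡ suc k * C * (K * M)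
    regroup = solve-∀
    regroup′ : ∀ m C K S → suc m * C * (K * S) ≡ C * (K * (suc m * S))
    regroup′ = solve-∀

  scaledBinomial-antitone : ∀ {n} k → 2 ≤ k → k + k ≤ n → scaledBinomial n k ≤ scaledBinomial n 2
  scaledBinomial-antitone 2 _ _ = ≤-refl
  scaledBinomial-antitone 1 (s≤s ()) _
  scaledBinomial-antitone {n} (suc k@(suc (suc _))) _ 2k+2≤n =
    ≤-trans (scaledBinomial-step {n} k<n∸k) (scaledBinomial-antitone k (s≤s (s≤s z≤n)) 2k≤n)
    where
    2k+1≤n : suc k + k ≤ n
    2k+1≤n = ≤-trans (+-monoʳ-≤ (suc k) (n≤1+n k)) 2k+2≤n
    k<n∸k : k < n ∸ k
    k<n∸k = m+n≤o⇒m≤o∸n (suc k) 2k+1≤n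
    2k≤n : k + k ≤ n
    2k≤n = ≤-trans (n≤1+n (k + k)) 2k+1≤n

  scaledBinomial-two : ∀ {n} → 4 ≤ n → 9 * scaledBinomial n 2 ≤ 8 * (n * (n ∸ 1) ^ (n ∸ 1))
  scaledBinomial-two (s≤s (s≤s (s≤s (s≤s {n = d} z≤n)))) = begin
      9 * (C₂ * (4 * M))          ≡⟨ regroup C₂ M ⟩
      2 * (2 * C₂) * (9 * M)      ≡⟨ cong (λ z → 2 * z * (9 * M)) 2*nC2≡[n∸1]*n ⟩
      2 * (suc m * n) * (9 * M)   ≤⟨ *-monoʳ-≤ (2 * (suc m * n)) ([1+1/n]^n-mono {2} {m} (s≤s (s≤s z≤n))) ⟩
      2 * (suc m * n) * (4 * S)   ≡⟨ regroup′ m n S ⟩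
      8 * (n * (suc m * S))       ∎
    where
    open ≤-Reasoning
    n m C₂ M S : ℕ
    n = 4 + d
    m = 2 + d
    C₂ = n C 2
    M = m ^ m
    S = suc m ^ m
    2*nC2≡[n∸1]*n : 2 * C₂ ≡ suc m * n
    2*nC2≡[n∸1]*n = trans ([k+1]*nC[k+1]≡[n∸k]*nCk {n} {1} (s≤s (s≤s z≤n))) (cong (suc m *_) (nC1≡n n))
    regroup : ∀ C M → 9 * (C * (4 * M)) ≡ 2 * (2 * C) * (9 * M)
    regroup = solve-∀
    regroup′ : ∀ m n S → 2 * (suc m * n) * (4 * S) ≡ 8 * (n * (suc m * S))
    regroup′ = solve-∀

  9*scaledBinomial≤8*n[n∸1]^[n∸1] : ∀ {n} k → 2 ≤ k → k + k ≤ n →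
                                    9 * scaledBinomial n k ≤ 8 * (n * (n ∸ 1) ^ (n ∸ 1))
  9*scaledBinomial≤8*n[n∸1]^[n∸1] k 2≤k 2k≤n =
    ≤-trans (*-monoʳ-≤ 9 (scaledBinomial-antitone k 2≤k 2k≤n))
            (scaledBinomial-two (≤-trans (+-mono-≤ 2≤k 2≤k) 2k≤n))

  n^n≢0 : ∀ n → NonZero (n ^ n)
  n^n≢0 zero    = _
  n^n≢0 (suc n) = m^n≢0 (suc n) (suc n)

  55*[k∸1]<6*n^2 : ∀ {n} k → 2 ≤ k → k + k ≤ n → 55 * (k ∸ 1) < 6 * n ^ 2
  55*[k∸1]<6*n^2 1 (s≤s ()) _
  55*[k∸1]<6*n^2 {n} k@(suc (suc t)) _ k+k≤n = begin-strict
      55 * suc t                  <⟨ *-monoˡ-< (suc t) (m<m+n 55 {41} z<s) ⟩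
      96 * suc t                  ≤⟨ m≤m+n (96 * suc t) (24 * (t * t)) ⟩
      96 * suc t + 24 * (t * t)   ≡⟨ expand t ⟩
      6 * (k + k) ^ 2             ≤⟨ *-monoʳ-≤ 6 (^-monoˡ-≤ 2 k+k≤n) ⟩
      6 * n ^ 2                   ∎
    where
    open ≤-Reasoning
    expand : ∀ t → 96 * suc t + 24 * (t * t)
                 ≡ 6 * ((suc (suc t) + suc (suc t)) * ((suc (suc t) + suc (suc t)) * 1))
    expand = solve-∀

module Exponential where
  open import Data.Nat as ℕ using (ℕ; zero; suc; _!)
  import Data.Nat.Properties as ℕ
  open import Data.Nat.Tactic.RingSolver using (solve-∀)
  open import Data.Integer as ℤ using (+_)
  import Data.Integer.Properties as ℤ
  open import Data.Rational
  open import Data.Rational.Properties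
  open import Data.Rational.Solver using (module +-*-Solver)
  import Data.Rational.Unnormalised as ℚᵘ
  import Data.Rational.Unnormalised.Properties as ℚᵘ
  open import Data.Product using (_,_)
  open import Relation.Binary.PropositionalEquality

  toℚᵘ-ratio : ∀ p b → toℚᵘ (ratio p (suc b)) ℚᵘ.≃ ℚᵘ.mkℚᵘ (+ p) b
  toℚᵘ-ratio p b = toℚᵘ-fromℚᵘ (ℚᵘ.mkℚᵘ (+ p) b)

  ratio-≤ : ∀ p q r s .{{_ : ℕ.NonZero q}} .{{_ : ℕ.NonZero s}} → p ℕ.* s ℕ.≤ r ℕ.* q → ratio p q ≤ ratio r s
  ratio-≤ p (suc b) r (suc d) ps≤rq = toℚᵘ-cancel-≤
    (ℚᵘ.≤-respˡ-≃ (ℚᵘ.≃-sym (toℚᵘ-ratio p b)) (ℚᵘ.≤-respʳ-≃ (ℚᵘ.≃-sym (toℚᵘ-ratio r d))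
      (ℚᵘ.*≤* (subst₂ ℤ._≤_ (ℤ.pos-* p (suc d)) (ℤ.pos-* r (suc b)) (ℤ.+≤+ ps≤rq)))))

  ratio-< : ∀ p q r s .{{_ : ℕ.NonZero q}} .{{_ : ℕ.NonZero s}} → p ℕ.* s ℕ.< r ℕ.* q → ratio p q < ratio r s
  ratio-< p (suc b) r (suc d) ps<rq = toℚᵘ-cancel-<
    (ℚᵘ.<-respˡ-≃ (ℚᵘ.≃-sym (toℚᵘ-ratio p b)) (ℚᵘ.<-respʳ-≃ (ℚᵘ.≃-sym (toℚᵘ-ratio r d))
      (ℚᵘ.*<* (subst₂ ℤ._<_ (ℤ.pos-* p (suc d)) (ℤ.pos-* r (suc b)) (ℤ.+<+ ps<rq)))))

  ratio-* : ∀ p q r s .{{_ : ℕ.NonZero q}} .{{_ : ℕ.NonZero s}} → ratio p q * ratio r s ≡ ratio (p ℕ.* r) (q ℕ.* s)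
  ratio-* p (suc b) r (suc d) = toℚᵘ-injective (begin
      toℚᵘ (ratio p (suc b) * ratio r (suc d))             ≈⟨ toℚᵘ-homo-* (ratio p (suc b)) (ratio r (suc d)) ⟩
      toℚᵘ (ratio p (suc b)) ℚᵘ.* toℚᵘ (ratio r (suc d))   ≈⟨ ℚᵘ.*-cong (toℚᵘ-ratio p b) (toℚᵘ-ratio r d) ⟩
      ℚᵘ.mkℚᵘ (+ p ℤ.* + r) bd                             ≡⟨ cong (λ z → ℚᵘ.mkℚᵘ z bd) (ℤ.pos-* p r) ⟨
      ℚᵘ.mkℚᵘ (+ (p ℕ.* r)) bd                             ≈⟨ toℚᵘ-ratio (p ℕ.* r) bd ⟨
      toℚᵘ (ratio (p ℕ.* r) (suc b ℕ.* suc d))             ∎)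
    where
    open ℚᵘ.≃-Reasoning
    bd : ℕ
    bd = ℕ.pred (suc b ℕ.* suc d)

  ratio-+ : ∀ p q r s .{{_ : ℕ.NonZero q}} .{{_ : ℕ.NonZero s}} →
            ratio p q + ratio r s ≡ ratio (p ℕ.* s ℕ.+ r ℕ.* q) (q ℕ.* s)
  ratio-+ p (suc b) r (suc d) = toℚᵘ-injective (begin
      toℚᵘ (ratio p (suc b) + ratio r (suc d))             ≈⟨ toℚᵘ-homo-+ (ratio p (suc b)) (ratio r (suc d)) ⟩
      toℚᵘ (ratio p (suc b)) ℚᵘ.+ toℚᵘ (ratio r (suc d))   ≈⟨ ℚᵘ.+-cong (toℚᵘ-ratio p b) (toℚᵘ-ratio r d) ⟩
      ℚᵘ.mkℚᵘ (+ p ℤ.* + suc d ℤ.+ + r ℤ.* + suc b) bd     ≡⟨ cong (λ z → ℚᵘ.mkℚᵘ z bd) numerator ⟩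
      ℚᵘ.mkℚᵘ (+ (p ℕ.* suc d ℕ.+ r ℕ.* suc b)) bd         ≈⟨ toℚᵘ-ratio (p ℕ.* suc d ℕ.+ r ℕ.* suc b) bd ⟨
      toℚᵘ (ratio (p ℕ.* suc d ℕ.+ r ℕ.* suc b) (suc b ℕ.* suc d)) ∎)
    where
    open ℚᵘ.≃-Reasoning
    bd : ℕ
    bd = ℕ.pred (suc b ℕ.* suc d)
    numerator : + p ℤ.* + suc d ℤ.+ + r ℤ.* + suc b ≡ + (p ℕ.* suc d ℕ.+ r ℕ.* suc b)
    numerator = trans (cong₂ ℤ._+_ (sym (ℤ.pos-* p (suc d))) (sym (ℤ.pos-* r (suc b))))
                      (sym (ℤ.pos-+ (p ℕ.* suc d) (r ℕ.* suc b)))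

  0≤* : ∀ {p q} → 0ℚ ≤ p → 0ℚ ≤ q → 0ℚ ≤ p * q
  0≤* {p} {q} 0≤p 0≤q = nonNegative⁻¹ (p * q) {{nonNeg*nonNeg⇒nonNeg p {{nonNegative 0≤p}} q {{nonNegative 0≤q}}}}

  0≤ratio : ∀ p q → 0ℚ ≤ ratio p q
  0≤ratio p zero    = ≤-refl
  0≤ratio p (suc b) = ratio-≤ 0 1 p (suc b) ℕ.z≤n

  0<ratio : ∀ p q .{{_ : ℕ.NonZero p}} .{{_ : ℕ.NonZero q}} → 0ℚ < ratio p q
  0<ratio p q = ratio-< 0 1 p q (subst (0 ℕ.<_) (sym (ℕ.*-identityʳ p)) (ℕ.>-nonZero⁻¹ p))

  ratio1≤1 : ∀ q → ratio 1 q ≤ 1ℚ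
  ratio1≤1 zero    = nonNegative⁻¹ 1ℚ
  ratio1≤1 (suc b) = ratio-≤ 1 (suc b) 1 1 (ℕ.s≤s ℕ.z≤n)

  0<* : ∀ {p q} → 0ℚ < p → 0ℚ < q → 0ℚ < p * q
  0<* {p} {q} 0<p 0<q = positive⁻¹ (p * q) {{pos*pos⇒pos p {{positive 0<p}} q {{positive 0<q}}}}

  0≤^ℚ : ∀ {a} → 0ℚ ≤ a → ∀ N → 0ℚ ≤ a ^ℚ N
  0≤^ℚ 0≤a zero    = nonNegative⁻¹ 1ℚ
  0≤^ℚ 0≤a (suc N) = 0≤* 0≤a (0≤^ℚ 0≤a N)

  expPartial-≤ : ∀ {a w} → 0ℚ ≤ a → 0ℚ ≤ w → 1ℚ + a * w ≤ w → ∀ N → expPartial a N ≤ w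
  expPartial-≤ {a} {w} 0≤a 0≤w 1+aw≤w N = begin
      expPartial a N                  ≡⟨ +-identityʳ _ ⟨
      expPartial a N + 0ℚ             ≤⟨ +-monoʳ-≤ (expPartial a N) (0≤* (0≤^ℚ 0≤a N) 0≤w) ⟩
      expPartial a N + a ^ℚ N * w     ≤⟨ invariant N ⟩
      w                               ∎
    where
    open ≤-Reasoning
    -- preserved since 1/N! ≤ 1 and 1 + a w ≤ w
    invariant : ∀ N → expPartial a N + a ^ℚ N * w ≤ w
    invariant zero    = ≤-reflexive (trans (+-identityˡ _) (*-identityˡ w))
    invariant (suc N) = begin
        E + t * u + a * t * w   ≡⟨ factor E t u a w ⟩
        E + t * (u + a * w)     ≤⟨ +-monoʳ-≤ E (*-monoˡ-≤-nonNeg t {{nonNegative (0≤^ℚ 0≤a N)}}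
                                      (≤-trans (+-monoˡ-≤ (a * w) (ratio1≤1 (N !))) 1+aw≤w)) ⟩
        E + t * w               ≤⟨ invariant N ⟩
        w                       ∎
      where
      E t u : ℚ
      E = expPartial a N
      t = a ^ℚ N
      u = ratio 1 (N !)
      factor : ∀ E t u a w → E + t * u + a * t * w ≡ E + t * (u + a * w)
      factor = solve 5 (λ E t u a w → E :+ t :* u :+ a :* t :* w := E :+ t :* (u :+ a :* w)) refl
        where open +-*-Solver

  expPartial-≤-10/9 : ∀ {a} → 0ℚ ≤ a → a ≤ ratio 1 10 → ∀ N → expPartial a N ≤ ratio 10 9
  expPartial-≤-10/9 {a} 0≤a a≤1/10 = expPartial-≤ 0≤a (0≤ratio 10 9)
    (+-monoʳ-≤ 1ℚ (*-monoʳ-≤-nonNeg (ratio 10 9) {{nonNegative (0≤ratio 10 9)}} a≤1/10))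

  <e^-·-if-9*≤8* : ∀ {a} C A B .{{_ : ℕ.NonZero C}} .{{_ : ℕ.NonZero B}} → 0ℚ ≤ a → a ≤ ratio 1 10 →
                   9 ℕ.* (C ℕ.* B) ℕ.≤ 8 ℕ.* A → ratio C 1 <e^- a · ratio A B
  <e^-·-if-9*≤8* {a} C A B 0≤a a≤1/10 9CB≤8A = δ , 0<* (0<ratio C 1) (0<ratio 1 72) , λ N → begin
      ratio C 1 * expPartial a N + δ             ≡⟨ *-distribˡ-+ (ratio C 1) (expPartial a N) (ratio 1 72) ⟨
      ratio C 1 * (expPartial a N + ratio 1 72)  ≤⟨ *-monoˡ-≤-nonNeg (ratio C 1) {{nonNegative (0≤ratio C 1)}}
                                                     (+-monoˡ-≤ (ratio 1 72) (expPartial-≤-10/9 0≤a a≤1/10 N)) ⟩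
      ratio C 1 * ratio 9 8                      ≡⟨ ratio-* C 1 9 8 ⟩
      ratio (C ℕ.* 9) 8                          ≤⟨ ratio-≤ (C ℕ.* 9) 8 A B (subst₂ ℕ._≤_ (rearrange C B) (ℕ.*-comm 8 A) 9CB≤8A) ⟩
      ratio A B                                  ∎
    where
    open ≤-Reasoning
    -- C·10/9 + δ = 9C/8
    δ : ℚ
    δ = ratio C 1 * ratio 1 72
    rearrange : ∀ C B → 9 ℕ.* (C ℕ.* B) ≡ C ℕ.* 9 ℕ.* B
    rearrange = solve-∀

  expPartial-2 : ∀ a → expPartial a 2 ≡ 1ℚ + a
  expPartial-2 a = cong (_+_ 1ℚ) (trans (*-identityʳ (a * 1ℚ)) (*-identityʳ a))

  e^-·<-if : ∀ {a b R} → 0ℚ < R → b * (1ℚ + a) < a → e^- a · R < ((1ℚ - b) * R)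
  e^-·<-if {a} {b} {R} 0<R b[1+a]<a = 2 , (begin-strict
      R                               ≡⟨ +-identityʳ R ⟨
      R + 0ℚ                          <⟨ +-monoʳ-< R (0<* 0<R 0<a-c) ⟩
      R + R * (a - c)                 ≡⟨ expand R a b ⟨
      (1ℚ - b) * R * (1ℚ + a)         ≡⟨ cong ((1ℚ - b) * R *_) (expPartial-2 a) ⟨
      (1ℚ - b) * R * expPartial a 2   ∎)
    where
    open ≤-Reasoning
    c : ℚ
    c = b * (1ℚ + a)
    0<a-c : 0ℚ < a - c
    0<a-c = subst (_< a - c) (+-inverseʳ c) (+-monoˡ-< (- c) b[1+a]<a)
    expand : ∀ R a b → (1ℚ - b) * R * (1ℚ + a) ≡ R + R * (a - b * (1ℚ + a))
    expand = solve 3 (λ R a b → (con 1ℚ :- b) :* R :* (con 1ℚ :+ a) := R :+ R :* (a :- b :* (con 1ℚ :+ a))) refl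
      where open +-*-Solver

  11K/12M≤1/10 : ∀ K M → 55 ℕ.* K ℕ.< 6 ℕ.* M → ratio (11 ℕ.* K) (12 ℕ.* M) ≤ ratio 1 10
  11K/12M≤1/10 K (suc M) 55K<6M = ratio-≤ (11 ℕ.* K) (12 ℕ.* suc M) 1 10
    (subst₂ ℕ._≤_ (double-55 K) (double-6 (suc M)) (ℕ.<⇒≤ (ℕ.*-monoʳ-< 2 55K<6M)))
    where
    double-55 : ∀ K → 2 ℕ.* (55 ℕ.* K) ≡ 11 ℕ.* K ℕ.* 10
    double-55 = solve-∀
    double-6 : ∀ M → 2 ℕ.* (6 ℕ.* M) ≡ 1 ℕ.* (12 ℕ.* M)
    double-6 = solve-∀

  5K/6M*[1+11K/12M]<11K/12M : ∀ K M .{{_ : ℕ.NonZero K}} → 55 ℕ.* K ℕ.< 6 ℕ.* M →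
                              ratio (5 ℕ.* K) (6 ℕ.* M) * (1ℚ + ratio (11 ℕ.* K) (12 ℕ.* M)) < ratio (11 ℕ.* K) (12 ℕ.* M)
  5K/6M*[1+11K/12M]<11K/12M K (suc M) 55K<6M = begin-strict
      ratio (5 ℕ.* K) (6 ℕ.* suc M) * (1ℚ + ratio (11 ℕ.* K) (12 ℕ.* suc M))
        ≡⟨ cong (ratio (5 ℕ.* K) (6 ℕ.* suc M) *_) (ratio-+ 1 1 (11 ℕ.* K) (12 ℕ.* suc M)) ⟩
      ratio (5 ℕ.* K) (6 ℕ.* suc M) * ratio P (1 ℕ.* (12 ℕ.* suc M))
        ≡⟨ ratio-* (5 ℕ.* K) (6 ℕ.* suc M) P (1 ℕ.* (12 ℕ.* suc M)) ⟩
      ratio (5 ℕ.* K ℕ.* P) (6 ℕ.* suc M ℕ.* (1 ℕ.* (12 ℕ.* suc M)))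
        <⟨ ratio-< (5 ℕ.* K ℕ.* P) (6 ℕ.* suc M ℕ.* (1 ℕ.* (12 ℕ.* suc M))) (11 ℕ.* K) (12 ℕ.* suc M) cross ⟩
      ratio (11 ℕ.* K) (12 ℕ.* suc M) ∎
    where
    open ≤-Reasoning
    P : ℕ
    P = 1 ℕ.* (12 ℕ.* suc M) ℕ.+ 11 ℕ.* K ℕ.* 1
    instance
      _ : ℕ.NonZero (K ℕ.* suc M ℕ.* 12)
      _ = ℕ.m*n≢0 (K ℕ.* suc M) 12 {{ℕ.m*n≢0 K (suc M)}}
    lhs : ∀ K M →
          5 ℕ.* K ℕ.* (1 ℕ.* (12 ℕ.* M) ℕ.+ 11 ℕ.* K ℕ.* 1) ℕ.* (12 ℕ.* M) ≡ K ℕ.* M ℕ.* 12 ℕ.* (60 ℕ.* M ℕ.+ 55 ℕ.* K)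
    lhs = solve-∀
    rhs : ∀ K M → K ℕ.* M ℕ.* 12 ℕ.* (60 ℕ.* M ℕ.+ 6 ℕ.* M) ≡ 11 ℕ.* K ℕ.* (6 ℕ.* M ℕ.* (1 ℕ.* (12 ℕ.* M)))
    rhs = solve-∀
    cross : 5 ℕ.* K ℕ.* P ℕ.* (12 ℕ.* suc M) ℕ.< 11 ℕ.* K ℕ.* (6 ℕ.* suc M ℕ.* (1 ℕ.* (12 ℕ.* suc M)))
    cross = subst₂ ℕ._<_ (sym (lhs K (suc M))) (rhs K (suc M))
              (ℕ.*-monoʳ-< (K ℕ.* suc M ℕ.* 12) (ℕ.+-monoʳ-< (60 ℕ.* suc M) 55K<6M))

open Binomial using (9*scaledBinomial≤8*n[n∸1]^[n∸1]; nCk≢0; n^n≢0; 55*[k∸1]<6*n^2)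
open Exponential using (<e^-·-if-9*≤8*; e^-·<-if; 0≤ratio; 0<ratio; 11K/12M≤1/10; 5K/6M*[1+11K/12M]<11K/12M)

open import Data.Nat using (ℕ; suc; s≤s; _≤_; _<_; _+_; _/_; _*_; _∸_; _^_; NonZero)
open import Data.Nat.Properties using (≤-trans; ≤-reflexive; *-monoˡ-≤; m≤m+n; m*n≢0)
open import Data.Nat.Combinatorics using (_C_)
open import Data.Nat.DivMod using (m/n*n≤m)
open import Data.Nat.Tactic.RingSolver using (solve-∀)
open import Data.Rational using (1ℚ) renaming (_-_ to _-ℚ_; _*_ to _*ℚ_)
open import Data.Product using (_×_; _,_)
open import Relation.Binary.PropositionalEquality using (_≡_)

theorem2p1 : (n k : ℕ) → 4 ≤ n → 2 ≤ k → k ≤ n / 2 →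
    (ratio (n C k) 1 <e^- ratio (11 * (k ∸ 1)) (12 * n ^ 2) · ratio (n * (n ∸ 1) ^ (n ∸ 1)) (k ^ k * (n ∸ k) ^ (n ∸ k)))
    × (e^- ratio (11 * (k ∸ 1)) (12 * n ^ 2) · ratio (n * (n ∸ 1) ^ (n ∸ 1)) (k ^ k * (n ∸ k) ^ (n ∸ k)) < ((1ℚ -ℚ ratio (5 * (k ∸ 1)) (6 * n ^ 2)) *ℚ ratio (n * (n ∸ 1) ^ (n ∸ 1)) (k ^ k * (n ∸ k) ^ (n ∸ k))))
-- The hypothesis 4 ≤ n is implied by 2 ≤ k ≤ n / 2.
theorem2p1 _ 1 _ (s≤s ()) _
theorem2p1 n@(suc _) k@(suc (suc _)) _ 2≤k k≤n/2 =
    <e^-·-if-9*≤8* (n C k) A B {{nCk≢0 k≤n}} (0≤ratio (11 * K) (12 * M)) (11K/12M≤1/10 K M 55K<6M)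
      (9*scaledBinomial≤8*n[n∸1]^[n∸1] k 2≤k k+k≤n)
  , e^-·<-if {b = ratio (5 * K) (6 * M)} (0<ratio A B) (5K/6M*[1+11K/12M]<11K/12M K M 55K<6M)
  where
  K M A B : ℕ
  K = k ∸ 1
  M = n ^ 2
  A = n * (n ∸ 1) ^ (n ∸ 1)
  B = k ^ k * (n ∸ k) ^ (n ∸ k)
  k+k≤n : k + k ≤ n
  k+k≤n = ≤-trans (≤-reflexive (double k)) (≤-trans (*-monoˡ-≤ 2 k≤n/2) (m/n*n≤m n 2))
    where
    double : ∀ k → k + k ≡ k * 2
    double = solve-∀
  k≤n : k ≤ n
  k≤n = ≤-trans (m≤m+n k k) k+k≤n
  55K<6M : 55 * K < 6 * M
  55K<6M = 55*[k∸1]<6*n^2 k 2≤k k+k≤n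
  instance
    _ : NonZero A
    _ = m*n≢0 n _ {{_}} {{n^n≢0 (n ∸ 1)}}
    _ : NonZero B
    _ = m*n≢0 _ _ {{n^n≢0 k}} {{n^n≢0 (n ∸ k)}}
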